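{- Let $(X;\overline{E})$ be an $(I,w)$-special $h$-structure. (1) If $\varnothing\neq I'\subseteq I$ and $2\leq v\leq w$, then there is $Y\subseteq X$ that induces an $(I',v)$-special $h$-substructure and $|Y|=v^{|I'|}$. (2) If $h\leq h'<\omega$, $I\subseteq I'\subseteq h'$ and $w\leq w'<\omega$, then there is an $(I',w')$-special $h'$-structure $(X';\overline{E'})$ such that $X'\supseteq X$ and $E_i=E'_i\cap X^2$ for $i\leq h$.
   Context: Each $n<\omega$ is identified with $\{0,\dots,n-1\}$. For $1\leq h<\omega$, an $h$-structure $(X;\overline E)=(X;E_0,\dots,E_{h-1})$ consists of a nonempty finite set $X$ and equivalence relations $E_i$ on $X$ ($i<h$) with $E_0=X\times X$ and $E_i\supseteq E_{i+1}$ for $i<h-1$; by convention $E_h$ denotes the identity (discrete) relation on $X$. For $\varnothing\neq Y\subseteq X$, $Y$ induces the $h$-substructure $(Y;E_0\cap Y^2,\dots,E_{h-1}\cap Y^2)$. The $h$-structure is $(I,w)$-special if $w\geq 2$ and: (i) $I=\{i<h: E_i$ is not discrete and $i=\max\{j<h:E_j=E_i\}\}$; (ii) for every $i\in I$ and every $E_i$-class $A$, the number of $E_{i+1}$-classes contained in $A$ is at least $w$. -}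

module Defs where

open import Data.Nat using (ℕ; zero; suc; _≤_; _^_)
open import Data.Fin using (Fin; zero; suc; inject₁; fromℕ; toℕ) renaming (_≤_ to _≤ᶠ_)
open import Data.Fin.Subset using (Subset; _∈_)
open import Data.Product using (_×_; Σ; ∃)
open import Relation.Nullary using (¬_; Dec)
open import Relation.Binary.PropositionalEquality using (_≡_)
open import Function.Bundles using (_⇔_)

FRel : ℕ → Set₁
FRel n = Fin n → Fin n → Set

-- Relations family of an h-structure on the universe X = Fin n:
-- R i = E_i for i ≤ h (index type Fin (suc h)), where R (fromℕ h) = E_h
-- is required to be the identity (the paper's convention).
record IsHStr (h n : ℕ) (R : Fin (suc h) → FRel n) : Set where
  field
    nonempty   : 1 ≤ n
    dec        : ∀ i x y → Dec (R i x y)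
    refl'      : ∀ i x → R i x x
    sym'       : ∀ i x y → R i x y → R i y x
    trans'     : ∀ i x y z → R i x y → R i y z → R i x z
    E0-full    : ∀ x y → R zero x y
    Eh-discr   : ∀ x y → R (fromℕ h) x y ⇔ (x ≡ y)
    decreasing : ∀ (i j : Fin (suc h)) → i ≤ᶠ j → ∀ x y → R j x y → R i x y

Discrete : ∀ {n} → FRel n → Set
Discrete {n} E = ∀ (x y : Fin n) → E x y → x ≡ y

SameRel : ∀ {n} → FRel n → FRel n → Set
SameRel {n} E F = ∀ (x y : Fin n) → E x y ⇔ F x y

InI : ∀ {h n} → (Fin (suc h) → FRel n) → Fin h → Set
InI {h} R i =
  (¬ Discrete (R (inject₁ i))) ×
  (∀ (j : Fin h) → SameRel (R (inject₁ j)) (R (inject₁ i)) → j ≤ᶠ i)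

-- The E_i-class A of x contains at least w distinct E_{i+1}-classes:
-- there are w elements of A that are pairwise E_{i+1}-inequivalent.
AtLeastClasses : ∀ {h n} → (Fin (suc h) → FRel n) → Fin h → Fin n → ℕ → Set
AtLeastClasses {h} {n} R i x w =
  Σ (Fin w → Fin n) λ f →
    (∀ k → R (inject₁ i) x (f k)) ×
    (∀ k l → R (suc i) (f k) (f l) → k ≡ l)

Special : (h n : ℕ) → (Fin (suc h) → FRel n) → Subset h → ℕ → Set
Special h n R I w =
  IsHStr h n R ×
  (2 ≤ w) ×
  (∀ (i : Fin h) → (i ∈ I) ⇔ InI R i) ×
  (∀ (i : Fin h) → i ∈ I → ∀ (x : Fin n) → AtLeastClasses R i x w)

Induced : ∀ {h m n} → (Fin (suc h) → FRel n) → (Fin m → Fin n) → Fin (suc h) → FRel m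
Induced R g i a b = R i (g a) (g b)

-- A structure is (I,w)-special iff E_i = E_{i+1} for i ∉ I and every E_i-class with i ∈ I contains w
-- pairwise E_{i+1}-inequivalent points (special-criterion); both constructions are checked against this.
-- (1) Fix v such points in every E_i-class, i ∈ I′. An address α : I′ → v then picks a descending path
-- x₀ = y₀ E_0 y₁ E_1 … whose step at level i ∈ I′ goes to the (α i)-th chosen point of the current class;
-- the endpoints of α and β are E_k-related exactly when α and β agree on I′ below k, so the v^|I′|
-- endpoints form Y.
-- (2) Take X′ = X × w′^{I′} with (x, α) E′_k (y, β) iff x E_k y (E_k the identity for k ≥ h) and α, β
-- agree on I′ below k; X sits inside as X × {α₀}.
module Submission where

open import Defs
open import Data.Bool using (true; false)
open import Data.Fin using (Fin; zero; suc; toℕ; fromℕ; fromℕ<; inject₁; inject≤; combine; remQuot; quotient; remainder; _≟_)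
open import Data.Fin.Properties
  using (toℕ-fromℕ; toℕ-fromℕ<; fromℕ<-toℕ; toℕ-inject₁; toℕ-inject≤; toℕ<n; toℕ-injective; 0≢1+n; nonZeroIndex; inject≤-injective; all?; remQuot-combine; combine-remQuot; combine-injectiveˡ)
open import Data.Fin.Subset using (Subset; _∈_; _∉_; _⊆_; ∣_∣; Nonempty)
open import Data.Fin.Subset.Properties using (_∈?_)
open import Data.Nat using (ℕ; zero; suc; _≤_; _<_; _^_; _*_; s≤s; z≤n; _<?_; _≤?_)
open import Data.Nat.Properties using (≤-refl; ≤-reflexive; ≤-trans; n≤1+n; <⇒≤; <⇒≢; m≤n⇒m<n∨m≡n; ≮⇒≥; ≰⇒>; 1+n≰n; *-mono-≤; m^n>0)
open import Data.Product using (_×_; _,_; proj₁; proj₂; Σ; map)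
open import Data.Sum using (inj₁; inj₂)
open import Data.Vec using (_∷_; []; here; there)
open import Data.Vec.Functional using (updateAt)
open import Data.Vec.Functional.Properties using (updateAt-updates; updateAt-minimal)
open import Function using (_∘_; const)
open import Function.Bundles using (_⇔_; mk⇔; Equivalence)
open import Function.Definitions using (Injective)
open import Relation.Binary.Core using (_⇒_)
open import Relation.Nullary using (¬_; Dec; yes; no; contradiction)
open import Relation.Nullary.Decidable using (_×-dec_; _→-dec_)
open import Relation.Binary.PropositionalEquality using (_≡_; refl; sym; trans; cong; cong₂; subst; subst₂)

clamp : (h : ℕ) → ℕ → Fin (suc h)
clamp zero    _       = zero
clamp (suc h) zero    = zero
clamp (suc h) (suc k) = suc (clamp h k)

clamp-zero : ∀ h → clamp h 0 ≡ zero
clamp-zero zero    = refl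
clamp-zero (suc h) = refl

clamp-toℕ : ∀ {h} (i : Fin (suc h)) → clamp h (toℕ i) ≡ i
clamp-toℕ {zero}  zero    = refl
clamp-toℕ {suc h} zero    = refl
clamp-toℕ {suc h} (suc i) = cong suc (clamp-toℕ i)

clamp-top : ∀ {h k} → h ≤ k → clamp h k ≡ fromℕ h
clamp-top {zero}          _       = refl
clamp-top {suc h} {suc k} (s≤s p) = cong suc (clamp-top p)

clamp-mono : ∀ {h k l} → k ≤ l → toℕ (clamp h k) ≤ toℕ (clamp h l)
clamp-mono {zero}                  _       = z≤n
clamp-mono {suc h} {zero}          _       = z≤n
clamp-mono {suc h} {suc k} {suc l} (s≤s p) = s≤s (clamp-mono {h} p)

MergesOutside : ∀ {h n} → (Fin (suc h) → FRel n) → Subset h → Set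
MergesOutside R I = ∀ {i} → i ∉ I → R (inject₁ i) ⇒ R (suc i)

SplitsOn : ∀ {h n} → (Fin (suc h) → FRel n) → Subset h → ℕ → Set
SplitsOn R I w = ∀ i → i ∈ I → ∀ x → AtLeastClasses R i x w

-- E k extends the chain E₀ ⊇ … ⊇ E_h to all k : ℕ by E_k = E_h (the identity) for k ≥ h.
module Levels {h n} {R : Fin (suc h) → FRel n} (H : IsHStr h n R) where
  open IsHStr H

  E : ℕ → FRel n
  E k = R (clamp h k)

  E-refl : ∀ {k x} → E k x x
  E-refl {k} = refl' (clamp h k) _

  E-sym : ∀ {k x y} → E k x y → E k y x
  E-sym {k} = sym' (clamp h k) _ _

  E-trans : ∀ {k x y z} → E k x y → E k y z → E k x z
  E-trans {k} = trans' (clamp h k) _ _ _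

  E-mono : ∀ {k l} → k ≤ l → E l ⇒ E k
  E-mono {k} {l} k≤l = decreasing (clamp h k) (clamp h l) (clamp-mono {h} k≤l) _ _

  E-full : ∀ x y → E 0 x y
  E-full x y rewrite clamp-zero h = E0-full x y

  E-discrete : ∀ {k x y} → h ≤ k → E k x y → x ≡ y
  E-discrete {x = x} {y} h≤k r = Equivalence.to (Eh-discr x y) (subst (λ i → R i x y) (clamp-top h≤k) r)

  R⇒E : ∀ {i} → R i ⇒ E (toℕ i)
  R⇒E {i} {x} {y} = subst (λ j → R j x y) (sym (clamp-toℕ i))

  E⇒R : ∀ {i} → E (toℕ i) ⇒ R i
  E⇒R {i} {x} {y} = subst (λ j → R j x y) (clamp-toℕ i)

  R⇒E-inject₁ : ∀ {i : Fin h} → R (inject₁ i) ⇒ E (toℕ i)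
  R⇒E-inject₁ {i} {x} {y} r = subst (λ k → E k x y) (toℕ-inject₁ i) (R⇒E r)

  E⇒R-inject₁ : ∀ {i : Fin h} → E (toℕ i) ⇒ R (inject₁ i)
  E⇒R-inject₁ {i} {x} {y} r = E⇒R (subst (λ k → E k x y) (sym (toℕ-inject₁ i)) r)

  split⇒InI : ∀ {i x y} → R (inject₁ i) x y → ¬ R (suc i) x y → InI R i
  split⇒InI {i} {x} {y} r ¬s = nonDiscrete , maximal
    where
    nonDiscrete : ¬ Discrete (R (inject₁ i))
    nonDiscrete D = ¬s (subst (R (suc i) x) (D x y r) (refl' (suc i) x))
    maximal : ∀ j → SameRel (R (inject₁ j)) (R (inject₁ i)) → toℕ j ≤ toℕ i
    maximal j same with toℕ j ≤? toℕ i
    ... | yes j≤i = j≤i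
    ... | no j≰i = contradiction (decreasing (suc i) (inject₁ j) below x y (Equivalence.from (same x y) r)) ¬s
      where
      below : suc (toℕ i) ≤ toℕ (inject₁ j)
      below = subst (suc (toℕ i) ≤_) (sym (toℕ-inject₁ j)) (≰⇒> j≰i)

  R-suc⇒R-inject₁ : ∀ {i : Fin h} → R (suc i) ⇒ R (inject₁ i)
  R-suc⇒R-inject₁ = E⇒R-inject₁ ∘ E-mono (n≤1+n _) ∘ R⇒E

  merged⇒¬InI : ∀ {i} → R (inject₁ i) ⇒ R (suc i) → ¬ InI R i
  merged⇒¬InI {i} merged (nonDiscrete , maximal) with suc (toℕ i) <? h
  ... | yes i+1<h = 1+n≰n (subst (_≤ toℕ i) (toℕ-fromℕ< i+1<h) (maximal (fromℕ< i+1<h) same))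
    where
    next : inject₁ (fromℕ< i+1<h) ≡ suc i
    next = toℕ-injective (trans (toℕ-inject₁ _) (toℕ-fromℕ< i+1<h))
    same : SameRel (R (inject₁ (fromℕ< i+1<h))) (R (inject₁ i))
    same x y rewrite next = mk⇔ R-suc⇒R-inject₁ merged
  ... | no i+1≮h = nonDiscrete (λ x y → E-discrete (≮⇒≥ i+1≮h) ∘ R⇒E ∘ merged)

  InI⊆⇒mergesOutside : ∀ {I} → (∀ i → InI R i → i ∈ I) → MergesOutside R I
  InI⊆⇒mergesOutside InI⇒∈ {i} i∉I {x} {y} r with dec (suc i) x y
  ... | yes s = s
  ... | no ¬s = contradiction (InI⇒∈ i (split⇒InI r ¬s)) i∉I

  special-criterion : ∀ {I v} → 2 ≤ v →
    MergesOutside R I →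
    SplitsOn R I v →
    Special h n R I v
  special-criterion {I} {suc (suc v)} 2≤v@(s≤s (s≤s _)) merged wide = H , 2≤v , (λ i → mk⇔ (∈⇒InI i) (InI⇒∈ i)) , wide
    where
    ∈⇒InI : ∀ i → i ∈ I → InI R i
    ∈⇒InI i i∈I with wide i i∈I (fromℕ< nonempty)
    ... | f , related , separated =
      split⇒InI (trans' (inject₁ i) _ _ _ (sym' (inject₁ i) _ _ (related zero)) (related (suc zero)))
                (λ s → contradiction (separated zero (suc zero) s) 0≢1+n)
    InI⇒∈ : ∀ i → InI R i → i ∈ I
    InI⇒∈ i inI with i ∈? I
    ... | yes i∈I = i∈I
    ... | no i∉I = contradiction inI (merged⇒¬InI (merged i∉I))

  E-merged : ∀ {I} → MergesOutside R I →
             ∀ {k} → (∀ {i} → toℕ i ≡ k → i ∉ I) → E k ⇒ E (suc k)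
  E-merged merged {k} outside {x} {y} r with k <? h
  ... | yes k<h = subst (λ k → E (suc k) x y) i≡k (R⇒E (merged (outside i≡k) (E⇒R-inject₁ (subst (λ k → E k x y) (sym i≡k) r))))
    where i≡k = toℕ-fromℕ< k<h
  ... | no k≮h = subst (E (suc k) x) (E-discrete (≮⇒≥ k≮h) r) E-refl

AgreeBelow : ∀ {h} {A : Set} → Subset h → ℕ → (Fin h → A) → (Fin h → A) → Set
AgreeBelow p k α β = ∀ l → l ∈ p → toℕ l < k → α l ≡ β l

module _ {h} {A : Set} {p : Subset h} where

  agree-refl : ∀ {k α} → AgreeBelow {A = A} p k α α
  agree-refl _ _ _ = refl

  agree-sym : ∀ {k} {α β : Fin h → A} → AgreeBelow p k α β → AgreeBelow p k β α
  agree-sym agr l l∈p l<k = sym (agr l l∈p l<k)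

  agree-trans : ∀ {k} {α β γ : Fin h → A} → AgreeBelow p k α β → AgreeBelow p k β γ → AgreeBelow p k α γ
  agree-trans agr agr′ l l∈p l<k = trans (agr l l∈p l<k) (agr′ l l∈p l<k)

  agree-mono : ∀ {k k′} → k ≤ k′ → AgreeBelow {A = A} p k′ ⇒ AgreeBelow p k
  agree-mono k≤k′ agr l l∈p l<k = agr l l∈p (≤-trans l<k k≤k′)

  agree-extend : ∀ {k} {α β : Fin h → A} → AgreeBelow p k α β →
                 (∀ l → l ∈ p → toℕ l ≡ k → α l ≡ β l) → AgreeBelow p (suc k) α β
  agree-extend agr new l l∈p (s≤s l≤k) with m≤n⇒m<n∨m≡n l≤k
  ... | inj₁ l<k = agr l l∈p l<k
  ... | inj₂ l≡k = new l l∈p l≡k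

  agree-extend-outside : ∀ {i} → i ∉ p → AgreeBelow {A = A} p (toℕ i) ⇒ AgreeBelow p (suc (toℕ i))
  agree-extend-outside i∉p agr = agree-extend agr (λ l l∈p l≡i → contradiction (subst (_∈ p) (toℕ-injective l≡i) l∈p) i∉p)

  agree-updateAt : ∀ {i f} (α : Fin h → A) → AgreeBelow p (toℕ i) α (updateAt α i f)
  agree-updateAt {i} α l _ l<i = sym (updateAt-minimal l i α (<⇒≢ l<i ∘ cong toℕ))

agree? : ∀ {h v} (p : Subset h) k (α β : Fin h → Fin v) → Dec (AgreeBelow p k α β)
agree? p k α β = all? (λ l → l ∈? p →-dec toℕ l <? k →-dec α l ≟ β l)

-- Codes a : Fin (v ^ ∣ p ∣) are the addresses Fin h → Fin v read only at the positions in p;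
-- decode fills the positions outside p with the junk digit d₀.
module Codes {v : ℕ} (d₀ : Fin v) where

  encode : ∀ {h} (p : Subset h) → (Fin h → Fin v) → Fin (v ^ ∣ p ∣)
  encode []          α = zero
  encode (true ∷ p)  α = combine (α zero) (encode p (α ∘ suc))
  encode (false ∷ p) α = encode p (α ∘ suc)

  decode : ∀ {h} (p : Subset h) → Fin (v ^ ∣ p ∣) → Fin h → Fin v
  decode (true ∷ p)  a zero    = quotient (v ^ ∣ p ∣) a
  decode (true ∷ p)  a (suc l) = decode p (remainder {v} (v ^ ∣ p ∣) a) l
  decode (false ∷ p) a zero    = d₀
  decode (false ∷ p) a (suc l) = decode p a l

  encode-decode : ∀ {h} (p : Subset h) a → encode p (decode p a) ≡ a
  encode-decode []          zero = refl
  encode-decode (true ∷ p)  a    =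
    trans (cong (combine {v} _) (encode-decode p _)) (combine-remQuot {v} (v ^ ∣ p ∣) a)
  encode-decode (false ∷ p) a    = encode-decode p a

  decode-encode : ∀ {h} (p : Subset h) α {l} → l ∈ p → decode p (encode p α) l ≡ α l
  decode-encode (true ∷ p)  α here        = cong proj₁ (remQuot-combine (α zero) _)
  decode-encode (true ∷ p)  α (there l∈p) =
    trans (cong (λ a → decode p a _) (cong proj₂ (remQuot-combine (α zero) _))) (decode-encode p (α ∘ suc) l∈p)
  decode-encode (false ∷ p) α (there l∈p) = decode-encode p (α ∘ suc) l∈p

  encode-cong : ∀ {h} (p : Subset h) {α β} → (∀ l → l ∈ p → α l ≡ β l) → encode p α ≡ encode p β
  encode-cong []          eq = refl
  encode-cong (true ∷ p)  eq = cong₂ combine (eq zero here) (encode-cong p (λ l → eq (suc l) ∘ there))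
  encode-cong (false ∷ p) eq = encode-cong p (λ l → eq (suc l) ∘ there)

  decode-injective : ∀ {h} (p : Subset h) {a b} → AgreeBelow p h (decode p a) (decode p b) → a ≡ b
  decode-injective p {a} {b} agr =
    trans (sym (encode-decode p a)) (trans (encode-cong p (λ l l∈p → agr l l∈p (toℕ<n l))) (encode-decode p b))

  setDigit : ∀ {h} (p : Subset h) → Fin (v ^ ∣ p ∣) → Fin h → Fin v → Fin (v ^ ∣ p ∣)
  setDigit p a i d = encode p (updateAt (decode p a) i (const d))

  decode-setDigit-below : ∀ {h} (p : Subset h) a i d → AgreeBelow p (toℕ i) (decode p a) (decode p (setDigit p a i d))
  decode-setDigit-below p a i d =
    agree-trans (agree-updateAt (decode p a)) (λ l l∈p _ → sym (decode-encode p _ l∈p))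

  decode-setDigit-at : ∀ {h} (p : Subset h) a {i} d → i ∈ p → decode p (setDigit p a i d) i ≡ d
  decode-setDigit-at p a {i} d i∈p = trans (decode-encode p _ i∈p) (updateAt-updates i (decode p a))

induced-isHStr : ∀ {h m n R} {g : Fin m → Fin n} →
  IsHStr h n R → Injective _≡_ _≡_ g → 1 ≤ m → IsHStr h m (Induced R g)
induced-isHStr {g = g} H g-injective 1≤m = record
  { nonempty   = 1≤m
  ; dec        = λ i a b → dec i (g a) (g b)
  ; refl'      = λ i a → refl' i (g a)
  ; sym'       = λ i a b → sym' i (g a) (g b)
  ; trans'     = λ i a b c → trans' i (g a) (g b) (g c)
  ; E0-full    = λ a b → E0-full (g a) (g b)
  ; Eh-discr   = λ a b → mk⇔ (g-injective ∘ Equivalence.to (Eh-discr (g a) (g b))) (λ { refl → refl' _ (g a) })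
  ; decreasing = λ i j i≤j a b → decreasing i j i≤j (g a) (g b)
  }
  where open IsHStr H

module Substructure {h n} {R : Fin (suc h) → FRel n} (H : IsHStr h n R) {I′ : Subset h} {w v}
  (wide : SplitsOn R I′ w) (v≤w : v ≤ w) (x₀ : Fin n) (d₀ : Fin v) where
  open IsHStr H
  open Levels H
  open Codes d₀

  Address : Set
  Address = Fin h → Fin v

  choose : Fin h → Fin n → Address → Fin n
  choose i x α with i ∈? I′
  ... | yes i∈I′ = proj₁ (wide i i∈I′ x) (inject≤ (α i) v≤w)
  ... | no _     = x

  choose-related : ∀ i x α → R (inject₁ i) x (choose i x α)
  choose-related i x α with i ∈? I′
  ... | yes i∈I′ = proj₁ (proj₂ (wide i i∈I′ x)) _
  ... | no _     = refl' _ x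

  choose-cong : ∀ i x {α β} → (i ∈ I′ → α i ≡ β i) → choose i x α ≡ choose i x β
  choose-cong i x eq with i ∈? I′
  ... | yes i∈I′ = cong (λ d → proj₁ (wide i i∈I′ x) (inject≤ d v≤w)) (eq i∈I′)
  ... | no _     = refl

  choose-separates : ∀ {i} x {α β} → i ∈ I′ → R (suc i) (choose i x α) (choose i x β) → α i ≡ β i
  choose-separates {i} x i∈I′ r with i ∈? I′
  ... | yes i∈I′ = inject≤-injective v≤w v≤w _ _ (proj₂ (proj₂ (wide i i∈I′ x)) _ _ r)
  ... | no i∉I′  = contradiction i∈I′ i∉I′

  extend : ℕ → Fin n → Address → Fin n
  extend k x α with k <? h
  ... | yes k<h = choose (fromℕ< k<h) x α
  ... | no _    = x

  extend-related : ∀ k x α → E k x (extend k x α)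
  extend-related k x α with k <? h
  ... | yes k<h = subst (λ k → E k x (choose (fromℕ< k<h) x α)) (toℕ-fromℕ< k<h) (R⇒E-inject₁ (choose-related _ x α))
  ... | no _    = E-refl

  extend-toℕ : ∀ i x α → extend (toℕ i) x α ≡ choose i x α
  extend-toℕ i x α with toℕ i <? h
  ... | yes i<h = cong (λ j → choose j x α) (fromℕ<-toℕ i i<h)
  ... | no i≮h  = contradiction (toℕ<n i) i≮h

  extend-cong : ∀ k x {α β} → AgreeBelow I′ (suc k) α β → extend k x α ≡ extend k x β
  extend-cong k x agr with k <? h
  ... | yes k<h = choose-cong _ x (λ i∈I′ → agr _ i∈I′ (s≤s (≤-reflexive (toℕ-fromℕ< k<h))))
  ... | no _    = refl

  node : ℕ → Address → Fin n
  node zero    α = x₀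
  node (suc k) α = extend k (node k α) α

  node-descends : ∀ {k} l α → k ≤ l → E k (node k α) (node l α)
  node-descends zero    α z≤n   = E-refl
  node-descends (suc l) α k≤1+l with m≤n⇒m<n∨m≡n k≤1+l
  ... | inj₁ (s≤s k≤l) = E-trans (node-descends l α k≤l) (E-mono k≤l (extend-related l _ α))
  ... | inj₂ refl      = E-refl

  node-cong : ∀ k {α β} → AgreeBelow I′ k α β → node k α ≡ node k β
  node-cong zero    agr = refl
  node-cong (suc k) {α} agr =
    trans (cong (λ x → extend k x α) (node-cong k (agree-mono (n≤1+n k) agr))) (extend-cong k _ agr)

  node-separates : ∀ {i α β} → i ∈ I′ → node (toℕ i) α ≡ node (toℕ i) β →
    E (suc (toℕ i)) (node (suc (toℕ i)) α) (node (suc (toℕ i)) β) → α i ≡ β i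
  node-separates {i} {α} {β} i∈I′ same r =
    choose-separates _ i∈I′ (E⇒R {suc i} (subst₂ (E (suc (toℕ i))) step-α step-β r))
    where
    step-α : node (suc (toℕ i)) α ≡ choose i (node (toℕ i) α) α
    step-α = extend-toℕ i _ α
    step-β : node (suc (toℕ i)) β ≡ choose i (node (toℕ i) α) β
    step-β = trans (cong (λ x → extend (toℕ i) x β) (sym same)) (extend-toℕ i _ β)

  path : Address → Fin n
  path = node h

  agree⇒path-related : ∀ {k α β} → k ≤ h → AgreeBelow I′ k α β → E k (path α) (path β)
  agree⇒path-related {k} {α} {β} k≤h agr =
    E-trans (E-sym (node-descends h α k≤h)) (subst (λ x → E k x (path β)) (sym (node-cong k agr)) (node-descends h β k≤h))

  path-separates : ∀ {i α β} → i ∈ I′ → AgreeBelow I′ (toℕ i) α β → E (suc (toℕ i)) (path α) (path β) → α i ≡ β i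
  path-separates {i} {α} {β} i∈I′ agr r =
    node-separates i∈I′ (node-cong _ agr)
      (E-trans (node-descends h α (toℕ<n i)) (E-trans r (E-sym (node-descends h β (toℕ<n i)))))

  path-related⇒agree : ∀ k {α β} → E k (path α) (path β) → AgreeBelow I′ k α β
  path-related⇒agree zero    r _ _ ()
  path-related⇒agree (suc k) r = agree-extend agr
    (λ l l∈I′ l≡k → path-separates l∈I′ (agree-mono (≤-reflexive l≡k) agr) (E-mono (s≤s (≤-reflexive l≡k)) r))
    where agr = path-related⇒agree k (E-mono (n≤1+n k) r)

  embed : Fin (v ^ ∣ I′ ∣) → Fin n
  embed = path ∘ decode I′

  embed-injective : Injective _≡_ _≡_ embed
  embed-injective {a} eq = decode-injective I′ (path-related⇒agree h (subst (E h (embed a)) eq E-refl))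

  embed-merged : MergesOutside (Induced R embed) I′
  embed-merged {i} i∉I′ =
    E⇒R {suc i} ∘ agree⇒path-related (toℕ<n i) ∘ agree-extend-outside i∉I′ ∘ path-related⇒agree (toℕ i) ∘ R⇒E-inject₁

  embed-wide : SplitsOn (Induced R embed) I′ v
  embed-wide i i∈I′ a = setDigit I′ a i , related , separated
    where
    related : ∀ d → Induced R embed (inject₁ i) a (setDigit I′ a i d)
    related d = E⇒R-inject₁ (agree⇒path-related (<⇒≤ (toℕ<n i)) (decode-setDigit-below I′ a i d))
    separated : ∀ d d′ → Induced R embed (suc i) (setDigit I′ a i d) (setDigit I′ a i d′) → d ≡ d′
    separated d d′ r = trans (sym (decode-setDigit-at I′ a d i∈I′))
      (trans (path-related⇒agree (suc (toℕ i)) (R⇒E {suc i} r) i i∈I′ ≤-refl) (decode-setDigit-at I′ a d′ i∈I′))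

  embed-special : 2 ≤ v → Special h (v ^ ∣ I′ ∣) (Induced R embed) I′ v
  embed-special 2≤v = Levels.special-criterion (induced-isHStr H embed-injective (m^n>0 v {{nonZeroIndex d₀}} ∣ I′ ∣))
    2≤v embed-merged embed-wide

special-substructure : ∀ {h n R I′ w v} → IsHStr h n R →
  SplitsOn R I′ w → 2 ≤ v → v ≤ w →
  Σ ℕ λ m → Σ (Fin m → Fin n) λ g → Injective _≡_ _≡_ g × (m ≡ v ^ ∣ I′ ∣) × Special h m (Induced R g) I′ v
special-substructure H wide 2≤v@(s≤s (s≤s _)) v≤w = _ , embed , embed-injective , refl , embed-special 2≤v
  where open Substructure H wide v≤w (fromℕ< (IsHStr.nonempty H)) zero

-- The set X × Fin N is represented as Fin (n * N) through combine / remQuot.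
module Extension {h n} {R : Fin (suc h) → FRel n} (H : IsHStr h n R) {I : Subset h}
  (merged : MergesOutside R I)
  {h′} (h≤h′ : h ≤ h′) {I′ : Subset h′} (I⊆I′ : ∀ i → i ∈ I → inject≤ i h≤h′ ∈ I′) {w′} (d₀ : Fin w′) where
  open IsHStr H
  open Levels H
  open Codes d₀

  N : ℕ
  N = w′ ^ ∣ I′ ∣

  Related : ℕ → Fin n × Fin N → Fin n × Fin N → Set
  Related k (x , a) (y , b) = E k x y × AgreeBelow I′ k (decode I′ a) (decode I′ b)

  Level : ℕ → FRel (n * N)
  Level k P Q = Related k (remQuot N P) (remQuot N Q)

  R′ : Fin (suc h′) → FRel (n * N)
  R′ i = Level (toℕ i)

  Level-combine : ∀ {k} x y a b → Level k (combine x a) (combine y b) ⇔ Related k (x , a) (y , b)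
  Level-combine {k} x y a b = mk⇔ (subst₂ (Related k) (remQuot-combine x a) (remQuot-combine y b))
                                  (subst₂ (Related k) (sym (remQuot-combine x a)) (sym (remQuot-combine y b)))

  remQuot-injective : ∀ {P Q} → remQuot {n} N P ≡ remQuot N Q → P ≡ Q
  remQuot-injective {P} {Q} eq =
    trans (sym (combine-remQuot {n} N P)) (trans (cong (λ (x , a) → combine x a) eq) (combine-remQuot {n} N Q))

  Level-mono : ∀ {k l} → k ≤ l → Level l ⇒ Level k
  Level-mono k≤l (e , agr) = E-mono k≤l e , agree-mono k≤l agr

  Level-discrete : ∀ {k P Q} → h′ ≤ k → Level k P Q → P ≡ Q
  Level-discrete h′≤k (e , agr) =
    remQuot-injective (cong₂ _,_ (E-discrete (≤-trans h≤h′ h′≤k) e) (decode-injective I′ (agree-mono h′≤k agr)))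

  isHStr : IsHStr h′ (n * N) R′
  isHStr = record
    { nonempty   = *-mono-≤ nonempty (m^n>0 w′ {{nonZeroIndex d₀}} ∣ I′ ∣)
    ; dec        = λ i P Q → dec (clamp h (toℕ i)) _ _ ×-dec agree? I′ (toℕ i) _ _
    ; refl'      = λ i P → E-refl , agree-refl
    ; sym'       = λ i P Q (e , agr) → E-sym e , agree-sym agr
    ; trans'     = λ i P Q S (e , agr) (e′ , agr′) → E-trans e e′ , agree-trans agr agr′
    ; E0-full    = λ P Q → E-full _ _ , λ _ _ ()
    ; Eh-discr   = λ P Q → mk⇔ (Level-discrete (≤-reflexive (sym (toℕ-fromℕ h′)))) (λ { refl → E-refl , agree-refl })
    ; decreasing = λ i j i≤j P Q → Level-mono i≤j
    }

  R′⇒Level : ∀ {j : Fin h′} → R′ (inject₁ j) ⇒ Level (toℕ j)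
  R′⇒Level {j} {P} {Q} = subst (λ k → Level k P Q) (toℕ-inject₁ j)

  Level⇒R′ : ∀ {j : Fin h′} → Level (toℕ j) ⇒ R′ (inject₁ j)
  Level⇒R′ {j} {P} {Q} = subst (λ k → Level k P Q) (sym (toℕ-inject₁ j))

  E-merged-outside : ∀ {j : Fin h′} → j ∉ I′ → E (toℕ j) ⇒ E (suc (toℕ j))
  E-merged-outside {j} j∉I′ = E-merged merged λ {i} i≡j i∈I →
    j∉I′ (subst (_∈ I′) (toℕ-injective (trans (toℕ-inject≤ i h≤h′) i≡j)) (I⊆I′ i i∈I))

  extension-merged : MergesOutside R′ I′
  extension-merged j∉I′ = map (E-merged-outside j∉I′) (agree-extend-outside j∉I′) ∘ R′⇒Level

  extension-wide-combine : ∀ j → j ∈ I′ → ∀ x a → AtLeastClasses R′ j (combine x a) w′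
  extension-wide-combine j j∈I′ x a = variant , related , separated
    where
    variant : Fin w′ → Fin (n * N)
    variant d = combine x (setDigit I′ a j d)
    related : ∀ d → R′ (inject₁ j) (combine x a) (variant d)
    related d = Level⇒R′ (Equivalence.from (Level-combine x x a _) (E-refl , decode-setDigit-below I′ a j d))
    separated : ∀ d d′ → R′ (suc j) (variant d) (variant d′) → d ≡ d′
    separated d d′ r = trans (sym (decode-setDigit-at I′ a d j∈I′))
      (trans (proj₂ (Equivalence.to (Level-combine x x _ _) r) j j∈I′ ≤-refl) (decode-setDigit-at I′ a d′ j∈I′))

  extension-wide : SplitsOn R′ I′ w′
  extension-wide j j∈I′ P = subst (λ P → AtLeastClasses R′ j P w′) (combine-remQuot {n} N P)
    (extension-wide-combine j j∈I′ (quotient N P) (remainder {n} N P))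

  embed : Fin n → Fin (n * N)
  embed x = combine x (encode I′ (const d₀))

  embed-injective : Injective _≡_ _≡_ embed
  embed-injective = combine-injectiveˡ _ _ _ _

  embed-restricts : ∀ i x y → R i x y ⇔ R′ (inject≤ i (s≤s h≤h′)) (embed x) (embed y)
  embed-restricts i x y = mk⇔
    (λ r → subst (λ k → Level k (embed x) (embed y)) (sym (toℕ-inject≤ i _)) (Equivalence.from (Level-combine x y _ _) (R⇒E r , agree-refl)))
    (λ r → E⇒R (proj₁ (Equivalence.to (Level-combine x y _ _) (subst (λ k → Level k (embed x) (embed y)) (toℕ-inject≤ i _) r))))

special-extension : ∀ {h n R I} → IsHStr h n R → MergesOutside R I →
  ∀ {h′} (h≤h′ : h ≤ h′) {I′ : Subset h′} → (∀ i → i ∈ I → inject≤ i h≤h′ ∈ I′) → ∀ {w′} → 2 ≤ w′ →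
  Σ ℕ λ n′ → Σ (Fin (suc h′) → FRel n′) λ R′ → Σ (Fin n → Fin n′) λ g →
    Injective _≡_ _≡_ g × Special h′ n′ R′ I′ w′ ×
    (∀ (i : Fin (suc h)) (x y : Fin n) → R i x y ⇔ R′ (inject≤ i (s≤s h≤h′)) (g x) (g y))
special-extension H merged h≤h′ I⊆I′ 2≤w′@(s≤s (s≤s _)) =
  _ , R′ , embed , embed-injective ,
  Levels.special-criterion isHStr 2≤w′ extension-merged extension-wide , embed-restricts
  where open Extension H merged h≤h′ I⊆I′ zero

proposition3p2 :
    (h n : ℕ) → 1 ≤ h → (R : Fin (suc h) → FRel n) → (I : Subset h) → (w : ℕ) →
    Special h n R I w →
    ((I′ : Subset h) → Nonempty I′ → I′ ⊆ I → (v : ℕ) → 2 ≤ v → v ≤ w →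
      Σ ℕ λ m → Σ (Fin m → Fin n) λ g →
        Injective _≡_ _≡_ g × (m ≡ v ^ ∣ I′ ∣) × Special h m (Induced R g) I′ v)
    ×
    ((h′ : ℕ) → (hh : h ≤ h′) → (I′ : Subset h′) →
      (∀ (i : Fin h) → i ∈ I → inject≤ i hh ∈ I′) → (w′ : ℕ) → w ≤ w′ →
      Σ ℕ λ n′ → Σ (Fin (suc h′) → FRel n′) λ R′ → Σ (Fin n → Fin n′) λ g →
        Injective _≡_ _≡_ g × Special h′ n′ R′ I′ w′ ×
        (∀ (i : Fin (suc h)) (x y : Fin n) → R i x y ⇔ R′ (inject≤ i (s≤s hh)) (g x) (g y)))
proposition3p2 h n _ R I w (H , 2≤w , ∈⇔InI , wide) =
  (λ I′ _ I′⊆I v 2≤v v≤w → special-substructure H (λ i → wide i ∘ I′⊆I) 2≤v v≤w) ,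
  (λ h′ h≤h′ I′ I⊆I′ w′ w≤w′ → special-extension H merged h≤h′ I⊆I′ (≤-trans 2≤w w≤w′))
  where
  merged : MergesOutside R I
  merged = Levels.InI⊆⇒mergesOutside H (λ i → Equivalence.from (∈⇔InI i))
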